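{- Let $\mathcal C$ be a category with a terminal object $1$ and limits of $\omega$-indexed chains, let $(T,\mu,\eta)$ be a monad and $F$ an endofunctor on $\mathcal C$, with pointwise extensions to $\mathrm{Sh}_{\mathcal C}(\omega)$. (1) If $\xi\colon\overline F{\blacktriangleright}\overline T\to\overline T\,\overline F{\blacktriangleright}$ is a distributive law of $\overline T$ over $\overline F\circ{\blacktriangleright}$, then the distributive law $\lambda\colon FT\to TF$ induced by $\xi$ (given by $\lambda_X=\xi_{\Delta X,n+2}$) is $\omega$-suitable. (2) If $\lambda\colon FT\to TF$ is an $\omega$-suitable distributive law, then there is a distributive law $\xi\colon\overline F{\blacktriangleright}\overline T\to\overline T\,\overline F{\blacktriangleright}$ of $\overline T$ over $\overline F\circ{\blacktriangleright}$ given on each sheaf $Y$ by $\xi_{Y,0}=\mathrm{id}_1$, $\xi_{Y,1}=\eta_{F1}$, $\xi_{Y,n+2}=\lambda_{Y_{n+1}}$ ($n<\omega$), and $\xi_{Y,\omega}$ the mediating map for the cone $\{\xi_{Y,n}\circ(\overline F{\blacktriangleright}\overline TY)_{\iota_{n,\omega}}\}_{n<\omega}$.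
   Context: A distributive law $\lambda\colon FT\to TF$ of the monad $T$ over $F$ is a natural transformation with $\lambda\circ F\mu=\mu_F\circ T\lambda\circ\lambda_T$ and $\lambda\circ F\eta=\eta_F$. It is $\omega$-suitable if for every object $X$, $TF(!_X)\circ\lambda_X=\eta_{F1}\circ F(!_{TX})\colon FTX\to TF1$, where $!$ denotes the unique map to $1$. $\mathrm{Sh}_{\mathcal C}(\omega)$: functors $X$ from $(\omega+1)^{op}$ (stages $0,1,\dots,\omega$) to $\mathcal C$ with $X_0\cong1$ and $X_\omega=\lim_nX_n$ via restrictions $X_{\iota_{\beta,\beta'}}$; morphisms natural transformations; $\Delta X$ constant sheaf ($X$ at stages $>0$, $1$ at $0$). Pointwise extension $\overline H$: $(\overline HY)_0=1$, $(\overline HY)_{n+1}=H(Y_{n+1})$ (restrictions and morphisms acted on by $H$), $(\overline HY)_\omega=\lim_n H(Y_{n+1})$; $\overline T$ is a monad with structure given by $\mu,\eta$ at successor stages. Later: $({\blacktriangleright}Y)_0=Y_0$, $({\blacktriangleright}Y)_{n+1}=Y_n$, $({\blacktriangleright}Y)_\omega=Y_\omega$. Thus $(\overline F{\blacktriangleright}\overline TY)_{n+2}=FTY_{n+1}$ and $(\overline T\,\overline F{\blacktriangleright}Y)_{n+2}=TFY_{n+1}$. -}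

module Defs where

open import Level using (Level; _⊔_) renaming (suc to lsuc)
open import Data.Nat using (ℕ; zero; suc)
open import Data.Product using (Σ; _×_; _,_)
open import Relation.Binary using (Rel; IsEquivalence; Setoid)
import Relation.Binary.Reasoning.Setoid as SetoidR

record Category (o ℓ e : Level) : Set (lsuc (o ⊔ ℓ ⊔ e)) where
  infixr 9 _∘_
  infix  4 _≈_
  field
    Obj       : Set o
    Hom       : Obj → Obj → Set ℓ
    _≈_       : ∀ {A B} → Rel (Hom A B) e
    id        : ∀ {A} → Hom A A
    _∘_       : ∀ {A B C} → Hom B C → Hom A B → Hom A C
    ≈-equiv   : ∀ {A B} → IsEquivalence (_≈_ {A} {B})
    ∘-resp-≈  : ∀ {A B C} {f h : Hom B C} {g i : Hom A B} →
                f ≈ h → g ≈ i → f ∘ g ≈ h ∘ i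
    assoc     : ∀ {A B C D} {f : Hom A B} {g : Hom B C} {h : Hom C D} →
                (h ∘ g) ∘ f ≈ h ∘ (g ∘ f)
    identityˡ : ∀ {A B} {f : Hom A B} → id ∘ f ≈ f
    identityʳ : ∀ {A B} {f : Hom A B} → f ∘ id ≈ f

  hom-setoid : Obj → Obj → Setoid ℓ e
  hom-setoid A B = record { Carrier = Hom A B ; _≈_ = _≈_ ; isEquivalence = ≈-equiv }

  module _ {A B : Obj} where
    open IsEquivalence (≈-equiv {A} {B}) public
      renaming (refl to ≈-refl; sym to ≈-sym; trans to ≈-trans)

  paste : ∀ {A B C A' B' C'} {a : Hom B' C'} {g : Hom B B'} {g' : Hom C C'}
            {b : Hom B C} {f : Hom A B} {f' : Hom A' C} {c : Hom A A'} →
          a ∘ g ≈ g' ∘ b → b ∘ f ≈ f' ∘ c → a ∘ (g ∘ f) ≈ (g' ∘ f') ∘ c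
  paste {a = a} {g} {g'} {b} {f} {f'} {c} sq₁ sq₂ = begin
      a ∘ (g ∘ f)      ≈⟨ ≈-sym assoc ⟩
      (a ∘ g) ∘ f      ≈⟨ ∘-resp-≈ sq₁ ≈-refl ⟩
      (g' ∘ b) ∘ f     ≈⟨ assoc ⟩
      g' ∘ (b ∘ f)     ≈⟨ ∘-resp-≈ ≈-refl sq₂ ⟩
      g' ∘ (f' ∘ c)    ≈⟨ ≈-sym assoc ⟩
      (g' ∘ f') ∘ c    ∎
    where open SetoidR (hom-setoid _ _)

record Terminal {o ℓ e} (C : Category o ℓ e) : Set (o ⊔ ℓ ⊔ e) where
  open Category C
  field
    𝟙        : Obj
    !        : ∀ {A} → Hom A 𝟙
    !-unique : ∀ {A} (f : Hom A 𝟙) → f ≈ !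

  !-eq : ∀ {A} (f g : Hom A 𝟙) → f ≈ g
  !-eq f g = ≈-trans (!-unique f) (≈-sym (!-unique g))

module _ {o ℓ e} (C : Category o ℓ e) where
  open Category C

  record Chain : Set (o ⊔ ℓ) where
    field
      D : ℕ → Obj
      d : ∀ n → Hom (D (suc n)) (D n)

  record IsLimit (c : Chain) (L : Obj) (π : ∀ n → Hom L (Chain.D c n))
                 (π-comm : ∀ n → Chain.d c n ∘ π (suc n) ≈ π n) : Set (o ⊔ ℓ ⊔ e) where
    open Chain c
    field
      mediate : ∀ {A} (p : ∀ n → Hom A (D n)) → (∀ n → d n ∘ p (suc n) ≈ p n) → Hom A L
      factors : ∀ {A} (p : ∀ n → Hom A (D n)) (pc : ∀ n → d n ∘ p (suc n) ≈ p n) →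
                ∀ n → π n ∘ mediate p pc ≈ p n
      unique  : ∀ {A} (p : ∀ n → Hom A (D n)) (pc : ∀ n → d n ∘ p (suc n) ≈ p n) →
                (m : Hom A L) → (∀ n → π n ∘ m ≈ p n) → m ≈ mediate p pc

  record Limit (c : Chain) : Set (o ⊔ ℓ ⊔ e) where
    field
      obj     : Obj
      π       : ∀ n → Hom obj (Chain.D c n)
      π-comm  : ∀ n → Chain.d c n ∘ π (suc n) ≈ π n
      isLimit : IsLimit c obj π π-comm

  HasChainLimits : Set (o ⊔ ℓ ⊔ e)
  HasChainLimits = (c : Chain) → Limit c

  record Endofunctor : Set (o ⊔ ℓ ⊔ e) where
    field
      F₀           : Obj → Obj
      F₁           : ∀ {A B} → Hom A B → Hom (F₀ A) (F₀ B)
      identity     : ∀ {A} → F₁ (id {A}) ≈ id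
      homomorphism : ∀ {A B C} {f : Hom A B} {g : Hom B C} → F₁ (g ∘ f) ≈ F₁ g ∘ F₁ f
      F-resp-≈     : ∀ {A B} {f g : Hom A B} → f ≈ g → F₁ f ≈ F₁ g

  record Monad : Set (o ⊔ ℓ ⊔ e) where
    field
      functor : Endofunctor
    open Endofunctor functor public renaming (F₀ to T₀; F₁ to T₁)
    field
      η        : ∀ X → Hom X (T₀ X)
      μ        : ∀ X → Hom (T₀ (T₀ X)) (T₀ X)
      η-nat    : ∀ {X Y} (f : Hom X Y) → T₁ f ∘ η X ≈ η Y ∘ f
      μ-nat    : ∀ {X Y} (f : Hom X Y) → T₁ f ∘ μ X ≈ μ Y ∘ T₁ (T₁ f)
      μ-assoc  : ∀ X → μ X ∘ T₁ (μ X) ≈ μ X ∘ μ (T₀ X)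
      μ-η-left : ∀ X → μ X ∘ η (T₀ X) ≈ id
      μ-η-right : ∀ X → μ X ∘ T₁ (η X) ≈ id

  record DistLaw (T : Monad) (F : Endofunctor) : Set (o ⊔ ℓ ⊔ e) where
    open Monad T
    open Endofunctor F
    field
      λ-map : ∀ X → Hom (F₀ (T₀ X)) (T₀ (F₀ X))
      natural : ∀ {X Y} (f : Hom X Y) → T₁ (F₁ f) ∘ λ-map X ≈ λ-map Y ∘ F₁ (T₁ f)
      law-μ : ∀ X → λ-map X ∘ F₁ (μ X) ≈ μ (F₀ X) ∘ (T₁ (λ-map X) ∘ λ-map (T₀ X))
      law-η : ∀ X → λ-map X ∘ F₁ (η X) ≈ η (F₀ X)

  OmegaSuitableMaps : (t : Terminal C) (T : Monad) (F : Endofunctor) →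
                      (∀ X → Hom (Endofunctor.F₀ F (Monad.T₀ T X)) (Monad.T₀ T (Endofunctor.F₀ F X))) →
                      Set (o ⊔ e)
  OmegaSuitableMaps t T F lam =
    ∀ X → T₁ (F₁ (! {X})) ∘ lam X ≈ η (F₀ 𝟙) ∘ F₁ (! {T₀ X})
    where open Terminal t; open Monad T; open Endofunctor F

  OmegaSuitable : (t : Terminal C) (T : Monad) (F : Endofunctor) → DistLaw T F → Set (o ⊔ e)
  OmegaSuitable t T F λ' = OmegaSuitableMaps t T F (DistLaw.λ-map λ')

module Sheaves {o ℓ e} (C : Category o ℓ e) (t : Terminal C) (lims : HasChainLimits C) where
  open Category C
  open Terminal t

  st : (ℕ → Obj) → ℕ → Obj
  st P zero    = 𝟙
  st P (suc n) = P n

  data Stage : Set where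
    fin : ℕ → Stage
    ω   : Stage

  -- A sheaf X : (ω+1)^op → C, given by its objects X_n (X_0 = 1), its
  -- restrictions X_{ι_{n,n+1}} = res n, X_{ι_{n,ω}} = proj n (all other
  -- restrictions are composites of these), such that X_ω = lim_n X_n.
  record Sheaf : Set (o ⊔ ℓ ⊔ e) where
    field
      pos       : ℕ → Obj
      res       : ∀ n → Hom (st pos (suc n)) (st pos n)
      top       : Obj
      proj      : ∀ n → Hom top (st pos n)
      proj-comm : ∀ n → res n ∘ proj (suc n) ≈ proj n
      isLimit   : IsLimit C (record { D = st pos ; d = res }) top proj proj-comm

    ob : Stage → Obj
    ob (fin n) = st pos n
    ob ω       = top

    chain : Chain C
    chain = record { D = st pos ; d = res }

  open Sheaf

  record ShMor (X Y : Sheaf) : Set (ℓ ⊔ e) where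
    field
      at   : ∀ n → Hom (st (pos X) n) (st (pos Y) n)
      atω  : Hom (top X) (top Y)
      nat  : ∀ n → res Y n ∘ at (suc n) ≈ at n ∘ res X n
      natω : ∀ n → proj Y n ∘ atω ≈ at n ∘ proj X n

    comp : (β : Stage) → Hom (ob X β) (ob Y β)
    comp (fin n) = at n
    comp ω       = atω

  open ShMor

  infix 4 _≈ˢ_
  _≈ˢ_ : ∀ {X Y} → ShMor X Y → ShMor X Y → Set e
  f ≈ˢ g = ∀ β → comp f β ≈ comp g β

  infixr 9 _∘ˢ_
  _∘ˢ_ : ∀ {X Y Z} → ShMor Y Z → ShMor X Y → ShMor X Z
  g ∘ˢ f = record
    { at   = λ n → at g n ∘ at f n
    ; atω  = atω g ∘ atω f
    ; nat  = λ n → paste (nat g n) (nat f n)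
    ; natω = λ n → paste (natω g n) (natω f n)
    }

  extend : ∀ {X Y} (a : ∀ n → Hom (st (pos X) n) (st (pos Y) n)) →
           (∀ n → res Y n ∘ a (suc n) ≈ a n ∘ res X n) → ShMor X Y
  extend {X} {Y} a an = record
    { at = a
    ; atω = IsLimit.mediate (isLimit Y) p pc
    ; nat = an
    ; natω = IsLimit.factors (isLimit Y) p pc
    }
    where
    p : ∀ n → Hom (top X) (st (pos Y) n)
    p n = a n ∘ proj X n
    pc : ∀ n → res Y n ∘ p (suc n) ≈ p n
    pc n = ≈-trans (≈-sym assoc)
             (≈-trans (∘-resp-≈ (an n) ≈-refl)
               (≈-trans assoc (∘-resp-≈ ≈-refl (proj-comm X n))))

  module Pointwise (H : Endofunctor C) where
    open Endofunctor H

    hres : (Y : Sheaf) → ∀ n → Hom (st (λ k → F₀ (pos Y k)) (suc n)) (st (λ k → F₀ (pos Y k)) n)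
    hres Y zero    = !
    hres Y (suc n) = F₁ (res Y (suc n))

    hchain : Sheaf → Chain C
    hchain Y = record { D = st (λ k → F₀ (pos Y k)) ; d = hres Y }

    ext : Sheaf → Sheaf
    ext Y = record
      { pos = λ k → F₀ (pos Y k)
      ; res = hres Y
      ; top = Limit.obj (lims (hchain Y))
      ; proj = Limit.π (lims (hchain Y))
      ; proj-comm = Limit.π-comm (lims (hchain Y))
      ; isLimit = Limit.isLimit (lims (hchain Y))
      }

    extMor : ∀ {X Y} → ShMor X Y → ShMor (ext X) (ext Y)
    extMor {X} {Y} f = extend a an
      where
      a : ∀ n → Hom (st (pos (ext X)) n) (st (pos (ext Y)) n)
      a zero    = id
      a (suc n) = F₁ (at f (suc n))
      an : ∀ n → res (ext Y) n ∘ a (suc n) ≈ a n ∘ res (ext X) n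
      an zero    = !-eq _ _
      an (suc n) = ≈-trans (≈-sym homomorphism)
                     (≈-trans (F-resp-≈ (nat f (suc n))) homomorphism)

  later : Sheaf → Sheaf
  later Y = record
    { pos = st (pos Y)
    ; res = r
    ; top = top Y
    ; proj = p
    ; proj-comm = pc
    ; isLimit = record
      { mediate = λ q qc → IsLimit.mediate (isLimit Y) (λ n → q (suc n)) (λ n → qc (suc n))
      ; factors = fa
      ; unique = λ q qc m h → IsLimit.unique (isLimit Y) (λ n → q (suc n)) (λ n → qc (suc n)) m (λ n → h (suc n))
      }
    }
    where
    r : ∀ n → Hom (st (st (pos Y)) (suc n)) (st (st (pos Y)) n)
    r zero    = id
    r (suc n) = res Y n
    p : ∀ n → Hom (top Y) (st (st (pos Y)) n)
    p zero    = proj Y 0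
    p (suc n) = proj Y n
    pc : ∀ n → r n ∘ p (suc n) ≈ p n
    pc zero    = identityˡ
    pc (suc n) = proj-comm Y n
    fa : ∀ {A} (q : ∀ n → Hom A (st (st (pos Y)) n)) (qc : ∀ n → r n ∘ q (suc n) ≈ q n) →
         ∀ n → p n ∘ IsLimit.mediate (isLimit Y) (λ n → q (suc n)) (λ n → qc (suc n)) ≈ q n
    fa q qc zero    = !-eq _ _
    fa q qc (suc n) = IsLimit.factors (isLimit Y) (λ k → q (suc k)) (λ k → qc (suc k)) n

  laterMor : ∀ {X Y} → ShMor X Y → ShMor (later X) (later Y)
  laterMor {X} {Y} f = record { at = a ; atω = atω f ; nat = an ; natω = aw }
    where
    a : ∀ n → Hom (st (pos (later X)) n) (st (pos (later Y)) n)
    a zero    = at f 0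
    a (suc n) = at f n
    an : ∀ n → res (later Y) n ∘ a (suc n) ≈ a n ∘ res (later X) n
    an zero    = ≈-trans identityˡ (≈-sym identityʳ)
    an (suc n) = nat f n
    aw : ∀ n → proj (later Y) n ∘ atω f ≈ a n ∘ proj (later X) n
    aw zero    = natω f 0
    aw (suc n) = natω f n

  Δ : Obj → Sheaf
  Δ X = record
    { pos = λ _ → X
    ; res = r
    ; top = X
    ; proj = p
    ; proj-comm = pc
    ; isLimit = record
      { mediate = λ q qc → q 1
      ; factors = fa
      ; unique = λ q qc m h → ≈-trans (≈-sym identityˡ) (h 1)
      }
    }
    where
    r : ∀ n → Hom (st (λ _ → X) (suc n)) (st (λ _ → X) n)
    r zero    = !
    r (suc n) = id
    p : ∀ n → Hom X (st (λ _ → X) n)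
    p zero    = !
    p (suc n) = id
    pc : ∀ n → r n ∘ p (suc n) ≈ p n
    pc zero    = !-eq _ _
    pc (suc n) = identityˡ
    allEq : ∀ {A} (q : ∀ n → Hom A (st (λ _ → X) n)) (qc : ∀ n → r n ∘ q (suc n) ≈ q n) →
            ∀ n → q (suc n) ≈ q 1
    allEq q qc zero    = ≈-refl
    allEq q qc (suc n) = ≈-trans (≈-trans (≈-sym identityˡ) (qc (suc n))) (allEq q qc n)
    fa : ∀ {A} (q : ∀ n → Hom A (st (λ _ → X) n)) (qc : ∀ n → r n ∘ q (suc n) ≈ q n) →
         ∀ n → p n ∘ q 1 ≈ q n
    fa q qc zero    = !-eq _ _
    fa q qc (suc n) = ≈-trans identityˡ (≈-sym (allEq q qc n))

  module Lifted (T : Monad C) (F : Endofunctor C) where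
    open Monad T
    open Endofunctor F using (F₀; F₁)
    module PT = Pointwise (Monad.functor T)
    module PF = Pointwise F

    T̄ : Sheaf → Sheaf
    T̄ = PT.ext
    T̄₁ : ∀ {X Y} → ShMor X Y → ShMor (T̄ X) (T̄ Y)
    T̄₁ = PT.extMor

    G : Sheaf → Sheaf
    G Y = PF.ext (later Y)
    G₁ : ∀ {X Y} → ShMor X Y → ShMor (G X) (G Y)
    G₁ f = PF.extMor (laterMor f)

    μ̄ : ∀ Y → ShMor (T̄ (T̄ Y)) (T̄ Y)
    μ̄ Y = extend a an
      where
      a : ∀ n → Hom (st (pos (T̄ (T̄ Y))) n) (st (pos (T̄ Y)) n)
      a zero    = id
      a (suc n) = μ (pos Y n)
      an : ∀ n → res (T̄ Y) n ∘ a (suc n) ≈ a n ∘ res (T̄ (T̄ Y)) n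
      an zero    = !-eq _ _
      an (suc n) = μ-nat (res Y (suc n))

    η̄ : ∀ Y → ShMor Y (T̄ Y)
    η̄ Y = extend a an
      where
      a : ∀ n → Hom (st (pos Y) n) (st (pos (T̄ Y)) n)
      a zero    = id
      a (suc n) = η (pos Y n)
      an : ∀ n → res (T̄ Y) n ∘ a (suc n) ≈ a n ∘ res Y n
      an zero    = !-eq _ _
      an (suc n) = η-nat (res Y (suc n))

    record ShDistLaw : Set (o ⊔ ℓ ⊔ e) where
      field
        ξ       : ∀ Y → ShMor (G (T̄ Y)) (T̄ (G Y))
        natural : ∀ {Y Y'} (f : ShMor Y Y') → ξ Y' ∘ˢ G₁ (T̄₁ f) ≈ˢ T̄₁ (G₁ f) ∘ˢ ξ Y
        law-μ   : ∀ Y → ξ Y ∘ˢ G₁ (μ̄ Y) ≈ˢ μ̄ (G Y) ∘ˢ (T̄₁ (ξ Y) ∘ˢ ξ (T̄ Y))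
        law-η   : ∀ Y → ξ Y ∘ˢ G₁ (η̄ Y) ≈ˢ η̄ (G Y)

    induced : ShDistLaw → ℕ → ∀ X → Hom (F₀ (T₀ X)) (T₀ (F₀ X))
    induced ξ' n X = at (ShDistLaw.ξ ξ' (Δ X)) (suc (suc n))

    HasComponents : DistLaw C T F → ShDistLaw → Set (o ⊔ ℓ ⊔ e)
    HasComponents λ' ξ' = ∀ Y →
        (at (ξ Y) 0 ≈ id)
      × (at (ξ Y) 1 ≈ η (F₀ 𝟙))
      × (∀ n → at (ξ Y) (suc (suc n)) ≈ DistLaw.λ-map λ' (pos Y n))
      × (∀ n → proj (T̄ (G Y)) n ∘ atω (ξ Y) ≈ at (ξ Y) n ∘ proj (G (T̄ Y)) n)
      where ξ = ShDistLaw.ξ ξ'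

{-# OPTIONS --safe #-}
-- A sheaf morphism is determined by its finite components, the ω-component
-- being a mediating map into a limit.  For ξ : F̄▶T̄ → T̄F̄▶, stage 0 is forced
-- by the terminal object, stage 1 by the unit law (it is η_{F1}), and at the
-- stages n+2 the laws of ξ are those of a distributive law FT → TF.  What
-- remains, the naturality square between stages 1 and 2, is ω-suitability.
-- On ΔX the restrictions above stage 1 are identities, so ξ_{ΔX,n+2} does not
-- depend on n.
module Submission where

open import Defs
open import Level using (Level)
open import Data.Nat using (ℕ; zero; suc)
open import Data.Product using (Σ; _×_; _,_)
import Relation.Binary.Reasoning.Setoid as SetoidR

module CategoryLemmas {o ℓ e} (C : Category o ℓ e) where
  open Category C

  elimʳ : ∀ {A B} {f : Hom A B} {g : Hom A A} → g ≈ id → f ∘ g ≈ f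
  elimʳ g≈id = ≈-trans (∘-resp-≈ ≈-refl g≈id) identityʳ

  elimˡ : ∀ {A B} {f : Hom B B} {g : Hom A B} → f ≈ id → f ∘ g ≈ g
  elimˡ f≈id = ≈-trans (∘-resp-≈ f≈id ≈-refl) identityˡ

  F-resp-id : (F : Endofunctor C) → ∀ {A} {h : Hom A A} → h ≈ id → Endofunctor.F₁ F h ≈ id
  F-resp-id F h≈id = ≈-trans (F-resp-≈ h≈id) identity
    where open Endofunctor F

  limit-ext : ∀ {c L π π-comm} → IsLimit C c L π π-comm →
              ∀ {A} {f g : Hom A L} → (∀ n → π n ∘ f ≈ π n ∘ g) → f ≈ g
  limit-ext {c} {π = π} {π-comm} lim {f = f} {g} πf≈πg =
    ≈-trans (unique p p-comm f (λ _ → ≈-refl))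
            (≈-sym (unique p p-comm g (λ n → ≈-sym (πf≈πg n))))
    where
    open IsLimit lim
    p : ∀ n → Hom _ (Chain.D c n)
    p n = π n ∘ f
    p-comm : ∀ n → Chain.d c n ∘ p (suc n) ≈ p n
    p-comm n = ≈-trans (≈-sym assoc) (∘-resp-≈ (π-comm n) ≈-refl)

module SheafLemmas {o ℓ e} (C : Category o ℓ e) (t : Terminal C) (lims : HasChainLimits C) where
  open Category C
  open Sheaves C t lims
  open Sheaf
  open ShMor
  open CategoryLemmas C

  ≈ˢ-finite : ∀ {X Y} {f g : ShMor X Y} → (∀ n → at f n ≈ at g n) → f ≈ˢ g
  ≈ˢ-finite f≈g (fin n) = f≈g n
  ≈ˢ-finite {X} {Y} {f} {g} f≈g ω = limit-ext (isLimit Y) agree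
    where
    agree : ∀ n → proj Y n ∘ atω f ≈ proj Y n ∘ atω g
    agree n = begin
      proj Y n ∘ atω f  ≈⟨ natω f n ⟩
      at f n ∘ proj X n ≈⟨ ∘-resp-≈ (f≈g n) ≈-refl ⟩
      at g n ∘ proj X n ≈⟨ ≈-sym (natω g n) ⟩
      proj Y n ∘ atω g  ∎
      where open SetoidR (hom-setoid _ _)

module DistributiveLaws {o ℓ e} (C : Category o ℓ e) (t : Terminal C) (lims : HasChainLimits C)
                        (T : Monad C) (F : Endofunctor C) where
  open Category C
  open Terminal t
  open Sheaves C t lims
  open Sheaf
  open ShMor
  open Lifted T F
  open CategoryLemmas C
  open SheafLemmas C t lims
  open Monad T using (T₀; T₁; η; η-nat; μ-η-right)
  open Endofunctor F using (F₀; F₁)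

  TF-resp-≈ : ∀ {A B} {f g : Hom A B} → f ≈ g → T₁ (F₁ f) ≈ T₁ (F₁ g)
  TF-resp-≈ f≈g = Monad.F-resp-≈ T (Endofunctor.F-resp-≈ F f≈g)

  TF-identity : ∀ {A} → T₁ (F₁ (id {A})) ≈ id
  TF-identity = F-resp-id (Monad.functor T) (Endofunctor.identity F)

  FT-identity : ∀ {A} → F₁ (T₁ (id {A})) ≈ id
  FT-identity = F-resp-id F (Monad.identity T)

  ηF𝟙-absorbs : (h : Hom 𝟙 𝟙) → η (F₀ 𝟙) ∘ F₁ h ≈ η (F₀ 𝟙)
  ηF𝟙-absorbs h = elimʳ (F-resp-id F (!-eq h id))

  module FromShDistLaw (ξ-law : ShDistLaw) where
    open ShDistLaw ξ-law

    ξ-at-1 : ∀ Y → at (ξ Y) 1 ≈ η (F₀ 𝟙)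
    ξ-at-1 Y = ≈-trans (≈-sym (elimʳ (Endofunctor.identity F))) (law-η Y (fin 1))

    ξ-at-2-suitable : ∀ Y → T₁ (F₁ (! {pos Y 0})) ∘ at (ξ Y) 2 ≈ η (F₀ 𝟙) ∘ F₁ (! {T₀ (pos Y 0)})
    ξ-at-2-suitable Y = begin
      T₁ (F₁ !) ∘ at (ξ Y) 2          ≈⟨ ∘-resp-≈ (TF-resp-≈ (≈-sym (!-unique (res Y 0)))) ≈-refl ⟩
      T₁ (F₁ (res Y 0)) ∘ at (ξ Y) 2  ≈⟨ nat (ξ Y) 1 ⟩
      at (ξ Y) 1 ∘ F₁ !               ≈⟨ ∘-resp-≈ (ξ-at-1 Y) ≈-refl ⟩
      η (F₀ 𝟙) ∘ F₁ !                 ∎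
      where open SetoidR (hom-setoid _ _)

    induced-suc : ∀ n X → induced ξ-law (suc n) X ≈ induced ξ-law n X
    induced-suc n X = begin
      ξ₃                    ≈⟨ ≈-sym (elimˡ TF-identity) ⟩
      T₁ (F₁ id) ∘ ξ₃       ≈⟨ nat (ξ (Δ X)) (suc (suc n)) ⟩
      ξ₂ ∘ F₁ (T₁ id)       ≈⟨ elimʳ FT-identity ⟩
      ξ₂                    ∎
      where
      open SetoidR (hom-setoid _ _)
      ξ₃ ξ₂ : Hom (F₀ (T₀ X)) (T₀ (F₀ X))
      ξ₃ = induced ξ-law (suc n) X
      ξ₂ = induced ξ-law n X

    induced-suitable : ∀ n → OmegaSuitableMaps C t T F (induced ξ-law n)
    induced-suitable zero    X = ξ-at-2-suitable (Δ X)
    induced-suitable (suc n) X =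
      ≈-trans (∘-resp-≈ ≈-refl (induced-suc n X)) (induced-suitable n X)

  module ToShDistLaw (λ-law : DistLaw C T F) (suitable : OmegaSuitable C t T F λ-law) where
    open DistLaw λ-law

    ξ-at : ∀ Y n → Hom (st (pos (G (T̄ Y))) n) (st (pos (T̄ (G Y))) n)
    ξ-at Y zero          = id
    ξ-at Y (suc zero)    = η (F₀ 𝟙)
    ξ-at Y (suc (suc n)) = λ-map (pos Y n)

    ξ-at-natural : ∀ Y n → res (T̄ (G Y)) n ∘ ξ-at Y (suc n) ≈ ξ-at Y n ∘ res (G (T̄ Y)) n
    ξ-at-natural Y zero          = !-eq _ _
    ξ-at-natural Y (suc zero)    =
      ≈-trans (∘-resp-≈ (TF-resp-≈ (!-unique (res Y 0))) ≈-refl) (suitable (pos Y 0))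
    ξ-at-natural Y (suc (suc n)) = natural (res Y (suc n))

    ξ : ∀ Y → ShMor (G (T̄ Y)) (T̄ (G Y))
    ξ Y = extend (ξ-at Y) (ξ-at-natural Y)

    ξ-natural-at : ∀ {Y Y'} (f : ShMor Y Y') n →
                   at (ξ Y' ∘ˢ G₁ (T̄₁ f)) n ≈ at (T̄₁ (G₁ f) ∘ˢ ξ Y) n
    ξ-natural-at f zero          = ≈-refl
    ξ-natural-at f (suc zero)    = ≈-trans (ηF𝟙-absorbs _)
      (≈-sym (≈-trans (η-nat _) (ηF𝟙-absorbs (at f 0))))
    ξ-natural-at f (suc (suc n)) = ≈-sym (natural (at f (suc n)))

    ξ-law-μ-at : ∀ Y n → at (ξ Y ∘ˢ G₁ (μ̄ Y)) n ≈ at (μ̄ (G Y) ∘ˢ (T̄₁ (ξ Y) ∘ˢ ξ (T̄ Y))) n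
    ξ-law-μ-at Y zero          = ≈-trans identityˡ (≈-sym (≈-trans identityˡ identityˡ))
    ξ-law-μ-at Y (suc zero)    = ≈-trans (ηF𝟙-absorbs id)
      (≈-sym (≈-trans (≈-sym assoc) (elimˡ (μ-η-right (F₀ 𝟙)))))
    ξ-law-μ-at Y (suc (suc n)) = law-μ (pos Y n)

    ξ-law-η-at : ∀ Y n → at (ξ Y ∘ˢ G₁ (η̄ Y)) n ≈ at (η̄ (G Y)) n
    ξ-law-η-at Y zero          = identityˡ
    ξ-law-η-at Y (suc zero)    = ηF𝟙-absorbs id
    ξ-law-η-at Y (suc (suc n)) = law-η (pos Y n)

    shDistLaw : ShDistLaw
    shDistLaw = record
      { ξ       = ξ
      ; natural = λ f → ≈ˢ-finite (ξ-natural-at f)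
      ; law-μ   = λ Y → ≈ˢ-finite (ξ-law-μ-at Y)
      ; law-η   = λ Y → ≈ˢ-finite (ξ-law-η-at Y)
      }

    shDistLaw-components : HasComponents λ-law shDistLaw
    shDistLaw-components Y = ≈-refl , ≈-refl , (λ _ → ≈-refl) , natω (ξ Y)

mainTheorem4 : ∀ {o ℓ e : Level}
    (C : Category o ℓ e) (t : Terminal C) (lims : HasChainLimits C)
    (T : Monad C) (F : Endofunctor C) →
    let open Sheaves.Lifted C t lims T F in
      ((ξ : ShDistLaw) → (n : ℕ) → OmegaSuitableMaps C t T F (induced ξ n))
    × ((λ' : DistLaw C T F) → OmegaSuitable C t T F λ' →
         Σ ShDistLaw (λ ξ → HasComponents λ' ξ))
mainTheorem4 C t lims T F =
    FromShDistLaw.induced-suitable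
  , λ λ-law suitable → ToShDistLaw.shDistLaw λ-law suitable
                     , ToShDistLaw.shDistLaw-components λ-law suitable
  where open DistributiveLaws C t lims T F
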